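{- Every $2$-tree is an induced subgraph of some $\alpha$-excellent $2$-tree.
   Context: All graphs are finite and simple. A $2$-tree is a graph obtainable from $K_2$ by finitely many applications of the operation: add a new vertex and join it to both ends of an existing edge. $\alpha(G)$ is the independence number; an $\alpha$-set is an independent set of size $\alpha(G)$; a graph $G$ is $\alpha$-excellent if every vertex of $G$ lies in some $\alpha$-set of $G$. -}

module Defs where

open import Data.Nat using (ℕ; zero; suc; _≤_)
open import Data.Fin using (Fin; zero; suc)
open import Data.Fin.Subset using (Subset; _∈_; ∣_∣)
open import Data.Product using (Σ; ∃; _×_; _,_)
open import Data.Sum using (_⊎_)
open import Data.Empty using (⊥)
open import Function using (_⇔_; _↔_; Injective)
open import Relation.Nullary using (¬_)
open import Relation.Binary.PropositionalEquality using (_≡_)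

record Graph (n : ℕ) : Set₁ where
  field
    Adj    : Fin n → Fin n → Set
    sym    : ∀ {i j} → Adj i j → Adj j i
    irrefl : ∀ {i} → ¬ Adj i i
open Graph public

K2Adj : Fin 2 → Fin 2 → Set
K2Adj zero zero = ⊥
K2Adj zero (suc zero) = Data.Unit.⊤ where import Data.Unit
K2Adj (suc zero) zero = Data.Unit.⊤ where import Data.Unit
K2Adj (suc zero) (suc zero) = ⊥

K2 : Graph 2
K2 = record { Adj = K2Adj ; sym = s ; irrefl = r }
  where
  s : ∀ {i j} → K2Adj i j → K2Adj j i
  s {zero} {zero} ()
  s {zero} {suc zero} p = p
  s {suc zero} {zero} p = p
  s {suc zero} {suc zero} ()
  r : ∀ {i} → ¬ K2Adj i i
  r {zero} ()
  r {suc zero} ()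

-- Add a new vertex (vertex zero; old vertex i becomes suc i) joined
-- to exactly the two ends u, v of an edge of G.
module _ {n : ℕ} (G : Graph n) (u v : Fin n) where
  ExtAdj : Fin (suc n) → Fin (suc n) → Set
  ExtAdj zero zero = ⊥
  ExtAdj zero (suc j) = j ≡ u ⊎ j ≡ v
  ExtAdj (suc i) zero = i ≡ u ⊎ i ≡ v
  ExtAdj (suc i) (suc j) = Adj G i j

  extend : Graph (suc n)
  extend = record { Adj = ExtAdj ; sym = λ {i} {j} → s {i} {j} ; irrefl = λ {i} → r {i} }
    where
    s : ∀ {i j} → ExtAdj i j → ExtAdj j i
    s {zero} {zero} ()
    s {zero} {suc j} p = p
    s {suc i} {zero} p = p
    s {suc i} {suc j} p = sym G {i} {j} p
    r : ∀ {i} → ¬ ExtAdj i i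
    r {zero} ()
    r {suc i} p = irrefl G {i} p

_≅_ : ∀ {n} → Graph n → Graph n → Set
_≅_ {n} G H = Σ (Fin n ↔ Fin n) λ f →
  ∀ i j → Adj G i j ⇔ Adj H (Function.Inverse.to f i) (Function.Inverse.to f j)
  where import Function

data TwoTree : ∀ {n} → Graph n → Set₁ where
  k2  : TwoTree K2
  ext : ∀ {n} {G : Graph n} → TwoTree G → ∀ u v → Adj G u v → TwoTree (extend G u v)
  iso : ∀ {n} {G H : Graph n} → TwoTree G → G ≅ H → TwoTree H

Independent : ∀ {n} → Graph n → Subset n → Set
Independent G S = ∀ i j → i ∈ S → j ∈ S → ¬ Adj G i j

IsAlphaSet : ∀ {n} → Graph n → Subset n → Set
IsAlphaSet {n} G S = Independent G S × (∀ T → Independent G T → ∣ T ∣ ≤ ∣ S ∣)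

AlphaExcellent : ∀ {n} → Graph n → Set
AlphaExcellent {n} G = ∀ (x : Fin n) → ∃ λ S → x ∈ S × IsAlphaSet G S

InducedSubgraph : ∀ {n m} → Graph n → Graph m → Set
InducedSubgraph {n} {m} H G = Σ (Fin n → Fin m) λ f →
  Injective _≡_ _≡_ f × (∀ i j → Adj H i j ⇔ Adj G (f i) (f j))

-- A graph whose vertices are partitioned into k cliques, each containing a
-- simplicial vertex (one whose neighbours all lie in its own clique), is
-- α-excellent with α = k: an independent set meets each clique at most once,
-- while any vertex x together with the simplicial vertices of the other
-- cliques is an independent set of size k.  A 2-tree T is padded into such a
-- 2-tree by hanging, at every vertex v, a vertex a on an edge vw of T and then
-- a vertex b on the edge va; the triangles {v, a, b} with b simplicial are
-- the cliques, and T stays induced because only new vertices are added.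
module Submission where

open import Level using (Level)
open import Defs hiding (sym)
open import Data.Nat using (ℕ; zero; suc; _≤_; _<_; z≤n; s≤s)
open import Data.Nat.Properties using (≤-trans; ≤-refl; n≤1+n; ≤∧≢⇒<; <⇒≱; m<1+n⇒m≤n)
open import Data.Fin using (Fin; zero; suc; toℕ; fromℕ<; _≟_)
open import Data.Fin.Properties using (0≢1+n; toℕ-injective; toℕ-fromℕ<; suc-injective; toℕ<n; any?)
open import Data.Fin.Subset using (Subset; _∈_; ∣_∣; ⊤; _-_; inside; outside)
open import Data.Fin.Subset.Properties using (∈⊤; ∣⊤∣≡n; x∈p∧x≢y⇒x∈p-y; x∈p⇒∣p-x∣<∣p∣)
open import Data.Vec using ([]; _∷_; here; there; tabulate)
open import Data.Vec.Properties using (lookup∘tabulate; []=⇒lookup; lookup⇒[]=)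
open import Data.Product using (Σ; ∃; _×_; _,_)
open import Data.Sum using (inj₁; inj₂)
open import Data.Unit using (tt)
open import Function using (_∘_; _⇔_; Injective; Inverse; Equivalence)
open import Relation.Nullary using (Dec; yes; no; does; contradiction)
open import Relation.Nullary.Decidable using (dec-true)
open import Relation.Unary using (Pred; Decidable)
open import Relation.Binary.PropositionalEquality
  using (_≡_; _≢_; refl; sym; trans; cong; subst)

private
  variable
    a b n : ℕ
    ℓ : Level

toSubset : {P : Pred (Fin n) ℓ} → Decidable P → Subset n
toSubset P? = tabulate (does ∘ P?)

∈-toSubset⁺ : {P : Pred (Fin n) ℓ} (P? : Decidable P) {i : Fin n} → P i → i ∈ toSubset P?
∈-toSubset⁺ P? {i} p = lookup⇒[]= i _ (trans (lookup∘tabulate _ i) (dec-true (P? i) p))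

∈-toSubset⁻ : {P : Pred (Fin n) ℓ} (P? : Decidable P) {i : Fin n} → i ∈ toSubset P? → P i
∈-toSubset⁻ P? {i} i∈ with P? i | trans (sym (lookup∘tabulate _ i)) ([]=⇒lookup i∈)
... | yes p | _ = p
... | no _  | ()

image : (Fin a → Fin b) → Subset b
image f = toSubset (λ y → any? (λ i → f i ≟ y))

∈-image⁺ : (f : Fin a → Fin b) (i : Fin a) → f i ∈ image f
∈-image⁺ f i = ∈-toSubset⁺ (λ y → any? (λ i → f i ≟ y)) (i , refl)

∈-image⁻ : (f : Fin a → Fin b) {y : Fin b} → y ∈ image f → ∃ λ i → f i ≡ y
∈-image⁻ f = ∈-toSubset⁻ (λ y → any? (λ i → f i ≟ y))

∣p∣≤∣q∣-injection : (p : Subset a) (q : Subset b) (f : Fin a → Fin b) →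
  (∀ {i} → i ∈ p → f i ∈ q) →
  (∀ {i j} → i ∈ p → j ∈ p → f i ≡ f j → i ≡ j) → ∣ p ∣ ≤ ∣ q ∣
∣p∣≤∣q∣-injection [] q f f∈ f-inj = z≤n
∣p∣≤∣q∣-injection (outside ∷ p) q f f∈ f-inj =
  ∣p∣≤∣q∣-injection p q (f ∘ suc) (f∈ ∘ there)
    (λ i∈ j∈ e → suc-injective (f-inj (there i∈) (there j∈) e))
∣p∣≤∣q∣-injection (inside ∷ p) q f f∈ f-inj =
  ≤-trans (s≤s (∣p∣≤∣q∣-injection p (q - f zero) (f ∘ suc)
      (λ i∈ → x∈p∧x≢y⇒x∈p-y (f∈ (there i∈)) (λ e → 0≢1+n (sym (f-inj (there i∈) here e))))
      (λ i∈ j∈ e → suc-injective (f-inj (there i∈) (there j∈) e))))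
    (x∈p⇒∣p-x∣<∣p∣ (f∈ here))

record SimplicialCliquePartition (G : Graph b) (k : ℕ) : Set where
  field
    class            : Fin b → Fin k
    simplicial       : Fin k → Fin b
    sameClass⇒adj    : ∀ {x y} → class x ≡ class y → x ≢ y → Adj G x y
    class-simplicial : ∀ i → class (simplicial i) ≡ i
    simplicial-nbr   : ∀ i {y} → Adj G (simplicial i) y → class y ≡ i

module _ {G : Graph b} {k : ℕ} (C : SimplicialCliquePartition G k) where
  open SimplicialCliquePartition C

  ∣independent∣≤k : ∀ T → Independent G T → ∣ T ∣ ≤ k
  ∣independent∣≤k T ind = subst (∣ T ∣ ≤_) (∣⊤∣≡n k)
    (∣p∣≤∣q∣-injection T ⊤ class (λ _ → ∈⊤) class-injective)
    where
    class-injective : ∀ {x y} → x ∈ T → y ∈ T → class x ≡ class y → x ≡ y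
    class-injective {x} {y} x∈ y∈ e with x ≟ y
    ... | yes x≡y = x≡y
    ... | no x≢y  = contradiction (sameClass⇒adj e x≢y) (ind x y x∈ y∈)

  module _ (x : Fin b) where

    transversal : Fin k → Fin b
    transversal i with i ≟ class x
    ... | yes _ = x
    ... | no _  = simplicial i

    transversal-own : transversal (class x) ≡ x
    transversal-own with class x ≟ class x
    ... | yes _ = refl
    ... | no c≢c = contradiction refl c≢c

    class-transversal : ∀ i → class (transversal i) ≡ i
    class-transversal i with i ≟ class x
    ... | yes i≡ = sym i≡
    ... | no _   = class-simplicial i

    transversal-nbr : ∀ {i y} → i ≢ class x → Adj G (transversal i) y → class y ≡ i
    transversal-nbr {i} i≢ adj with i ≟ class x
    ... | yes i≡ = contradiction i≡ i≢
    ... | no _   = simplicial-nbr i adj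

    transversal-adj⇒≡ : ∀ {i j} → Adj G (transversal i) (transversal j) → i ≡ j
    transversal-adj⇒≡ {i} {j} adj = cases (i ≟ class x) (j ≟ class x)
      where
      cases : Dec (i ≡ class x) → Dec (j ≡ class x) → i ≡ j
      cases (yes i≡) (yes j≡) = trans i≡ (sym j≡)
      cases (no i≢)  _        = trans (sym (transversal-nbr i≢ adj)) (class-transversal j)
      cases (yes _)  (no j≢)  = trans (sym (class-transversal i)) (transversal-nbr j≢ (Graph.sym G adj))

    transversal-independent : Independent G (image transversal)
    transversal-independent y z y∈ z∈ adj with ∈-image⁻ transversal y∈ | ∈-image⁻ transversal z∈
    ... | i , refl | j , refl =
      irrefl G {transversal i}
        (subst (λ l → Adj G (transversal i) (transversal l)) (sym (transversal-adj⇒≡ {i} {j} adj)) adj)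

    k≤∣transversal∣ : k ≤ ∣ image transversal ∣
    k≤∣transversal∣ = subst (_≤ ∣ image transversal ∣) (∣⊤∣≡n k)
      (∣p∣≤∣q∣-injection ⊤ (image transversal) transversal (λ {i} _ → ∈-image⁺ transversal i)
        (λ {i} {j} _ _ e → trans (sym (class-transversal i)) (trans (cong class e) (class-transversal j))))

  simplicialCliquePartition⇒alphaExcellent : AlphaExcellent G
  simplicialCliquePartition⇒alphaExcellent x =
    image (transversal x) ,
    subst (_∈ image (transversal x)) (transversal-own x) (∈-image⁺ (transversal x) (class x)) ,
    transversal-independent x ,
    λ T ind → ≤-trans (∣independent∣≤k T ind) (k≤∣transversal∣ x)

twoTree-neighbour : {G : Graph n} → TwoTree G → ∀ x → ∃ (Adj G x)
twoTree-neighbour k2 zero = suc zero , tt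
twoTree-neighbour k2 (suc zero) = zero , tt
twoTree-neighbour (ext t u v _) zero = suc u , inj₁ refl
twoTree-neighbour (ext t u v _) (suc x) with twoTree-neighbour t x
... | y , adj = suc y , adj
twoTree-neighbour {G = H} (iso t (f , f-adj)) x with twoTree-neighbour t (Inverse.from f x)
... | y , adj = Inverse.to f y ,
  subst (λ z → Adj H z (Inverse.to f y)) (Inverse.strictlyInverseˡ f x)
    (Equivalence.to (f-adj (Inverse.from f x) y) adj)

-- The vertices i with toℕ i < p have been padded; every other vertex of T is
-- still alone in its class, with itself as simplicial representative.
record Padded (T : Graph n) (p : ℕ) : Set₁ where
  field
    m                : ℕ
    H                : Graph m
    twoTree          : TwoTree H
    embed            : Fin n → Fin m
    embed-injective  : Injective _≡_ _≡_ embed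
    embed-adj        : ∀ i j → Adj T i j ⇔ Adj H (embed i) (embed j)
    class            : Fin m → Fin n
    simplicial       : Fin n → Fin m
    sameClass⇒adj    : ∀ {x y} → class x ≡ class y → x ≢ y → Adj H x y
    class-simplicial : ∀ i → class (simplicial i) ≡ i
    class-embed      : ∀ i → class (embed i) ≡ i
    simplicial-nbr   : ∀ i → toℕ i < p → ∀ {y} → Adj H (simplicial i) y → class y ≡ i
    simplicial≢embed : ∀ i → toℕ i < p → ∀ j → simplicial i ≢ embed j
    unpadded         : ∀ x → p ≤ toℕ (class x) → x ≡ embed (class x)

padded-zero : (T : Graph n) → TwoTree T → Padded T 0
padded-zero T t = record
  { H = T ; twoTree = t ; embed = λ i → i ; embed-injective = λ e → e
  ; embed-adj = λ i j → record { to = λ a → a ; from = λ a → a ; to-cong = λ e → e ; from-cong = λ e → e }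
  ; class = λ x → x ; simplicial = λ i → i
  ; sameClass⇒adj = λ e x≢y → contradiction e x≢y
  ; class-simplicial = λ _ → refl ; class-embed = λ _ → refl
  ; simplicial-nbr = λ _ () ; simplicial≢embed = λ _ ()
  ; unpadded = λ _ _ → refl }

module PadVertex {T : Graph n} {p : ℕ} (P : Padded T p) (v w : Fin n)
  (v~w : Adj T v w) (v≡p : toℕ v ≡ p) where
  open Padded P

  u : Fin m
  u = embed v

  lift₂ : Fin m → Fin (suc (suc m))
  lift₂ x = suc (suc x)

  -- Vertex suc zero is a (on the edge u w), vertex zero is b (on the edge u a).
  H' : Graph (suc (suc m))
  H' = extend (extend H u (embed w)) (suc u) zero

  twoTree' : TwoTree H'
  twoTree' = ext (ext twoTree u (embed w) (Equivalence.to (embed-adj v w) v~w)) (suc u) zero (inj₁ refl)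

  class' : Fin (suc (suc m)) → Fin n
  class' zero = v
  class' (suc zero) = v
  class' (suc (suc x)) = class x

  simplicial' : Fin n → Fin (suc (suc m))
  simplicial' i with i ≟ v
  ... | yes _ = zero
  ... | no _  = lift₂ (simplicial i)

  class≡v⇒≡u : ∀ {x} → class x ≡ v → x ≡ u
  class≡v⇒≡u {x} e = trans (unpadded x (subst (p ≤_) (sym (trans (cong toℕ e) v≡p)) ≤-refl))
                           (cong embed e)

  sameClass⇒adj' : ∀ {x y} → class' x ≡ class' y → x ≢ y → Adj H' x y
  sameClass⇒adj' {zero}          {zero}          _ x≢y = contradiction refl x≢y
  sameClass⇒adj' {zero}          {suc zero}      _ _   = inj₂ refl
  sameClass⇒adj' {zero}          {suc (suc y)}   e _   = inj₁ (cong suc (class≡v⇒≡u (sym e)))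
  sameClass⇒adj' {suc zero}      {zero}          _ _   = inj₂ refl
  sameClass⇒adj' {suc zero}      {suc zero}      _ x≢y = contradiction refl x≢y
  sameClass⇒adj' {suc zero}      {suc (suc y)}   e _   = inj₁ (class≡v⇒≡u (sym e))
  sameClass⇒adj' {suc (suc x)}   {zero}          e _   = inj₁ (cong suc (class≡v⇒≡u e))
  sameClass⇒adj' {suc (suc x)}   {suc zero}      e _   = inj₁ (class≡v⇒≡u e)
  sameClass⇒adj' {suc (suc x)}   {suc (suc y)}   e x≢y = sameClass⇒adj {x} {y} e (x≢y ∘ cong lift₂)

  class-simplicial' : ∀ i → class' (simplicial' i) ≡ i
  class-simplicial' i with i ≟ v
  ... | yes i≡v = sym i≡v
  ... | no _    = class-simplicial i

  <1+p∧≢v⇒<p : ∀ {i} → toℕ i < suc p → i ≢ v → toℕ i < p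
  <1+p∧≢v⇒<p i<1+p i≢v =
    ≤∧≢⇒< (m<1+n⇒m≤n i<1+p) (λ i≡p → i≢v (toℕ-injective (trans i≡p (sym v≡p))))

  simplicial-nbr' : ∀ i → toℕ i < suc p → ∀ {y} → Adj H' (simplicial' i) y → class' y ≡ i
  simplicial-nbr' i i<1+p {y} adj with i ≟ v
  simplicial-nbr' i _ {suc (suc y)} (inj₁ refl) | yes i≡v = trans (class-embed v) (sym i≡v)
  simplicial-nbr' i _ {suc zero}    (inj₂ refl) | yes i≡v = sym i≡v
  ... | no i≢v = old y adj
    where
    i<p : toℕ i < p
    i<p = <1+p∧≢v⇒<p i<1+p i≢v
    old : ∀ y → Adj H' (lift₂ (simplicial i)) y → class' y ≡ i
    old zero          (inj₁ e) = contradiction (suc-injective e) (simplicial≢embed i i<p v)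
    old (suc zero)    (inj₁ e) = contradiction e (simplicial≢embed i i<p v)
    old (suc zero)    (inj₂ e) = contradiction e (simplicial≢embed i i<p w)
    old (suc (suc y)) adj'     = simplicial-nbr i i<p adj'

  simplicial≢embed' : ∀ i → toℕ i < suc p → ∀ j → simplicial' i ≢ lift₂ (embed j)
  simplicial≢embed' i i<1+p j with i ≟ v
  ... | yes _  = λ ()
  ... | no i≢v = simplicial≢embed i (<1+p∧≢v⇒<p i<1+p i≢v) j ∘ suc-injective ∘ suc-injective

  unpadded' : ∀ x → suc p ≤ toℕ (class' x) → x ≡ lift₂ (embed (class' x))
  unpadded' zero          p<v = contradiction (subst (_≤ p) (sym v≡p) ≤-refl) (<⇒≱ p<v)
  unpadded' (suc zero)    p<v = contradiction (subst (_≤ p) (sym v≡p) ≤-refl) (<⇒≱ p<v)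
  unpadded' (suc (suc x)) p<c = cong lift₂ (unpadded x (≤-trans (n≤1+n p) p<c))

  padded-suc : Padded T (suc p)
  padded-suc = record
    { H = H' ; twoTree = twoTree' ; embed = lift₂ ∘ embed
    ; embed-injective = embed-injective ∘ suc-injective ∘ suc-injective
    ; embed-adj = embed-adj
    ; class = class' ; simplicial = simplicial'
    ; sameClass⇒adj = sameClass⇒adj' ; class-simplicial = class-simplicial'
    ; class-embed = class-embed ; simplicial-nbr = simplicial-nbr'
    ; simplicial≢embed = simplicial≢embed' ; unpadded = unpadded' }

padded : {T : Graph n} → TwoTree T → ∀ p → p ≤ n → Padded T p
padded t zero _ = padded-zero _ t
padded t (suc p) p<n with twoTree-neighbour t (fromℕ< p<n)
... | w , v~w =
  PadVertex.padded-suc (padded t p (≤-trans (n≤1+n p) p<n)) (fromℕ< p<n) w v~w (toℕ-fromℕ< p<n)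

fullyPadded⇒partition : {T : Graph n} (P : Padded T n) →
  SimplicialCliquePartition (Padded.H P) n
fullyPadded⇒partition P = record
  { class = class ; simplicial = simplicial ; sameClass⇒adj = sameClass⇒adj
  ; class-simplicial = class-simplicial
  ; simplicial-nbr = λ i → simplicial-nbr i (toℕ<n i) }
  where open Padded P

corollary1 : ∀ {n} (T : Graph n) → TwoTree T →
    Σ ℕ λ m → Σ (Graph m) λ G → TwoTree G × AlphaExcellent G × InducedSubgraph T G
corollary1 {n} T t =
  m , H , twoTree , simplicialCliquePartition⇒alphaExcellent (fullyPadded⇒partition P) ,
  embed , embed-injective , embed-adj
  where
  P : Padded T n
  P = padded t n ≤-refl
  open Padded P
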